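{- Let $m \geq 1$ and $k \geq 2$ be integers, let $G$ be a chordal graph, and let $w$ and $w'$ be $m$-weightings of $G$ such that $w'$ is uniform-$\alpha$. Then $\pi_k(G(w')) \leq \pi_k(G(w))$.
   Context: All graphs are simple. $\mathbb{N}_0 = \{0,1,2,\dots\}$, $[n]=\{1,\dots,n\}$. For a graph $G$, a function $w: V(G) \to \mathbb{N}_0$ with $\sum_{v \in V(G)} w(v) = m$ is an $m$-weighting of $G$. $G(w)$ is the graph obtained from $G$ by replacing each vertex $v$ by a clique $K^v$ on $w(v)$ vertices and joining every vertex of $K^u$ to every vertex of $K^v$ whenever $uv \in E(G)$. $\pi_k(H)$ denotes the number of $k$-cliques of a graph $H$. For $U \subseteq V(G)$, an $m$-weighting $w$ is uniform on $U$ if $w(v)=0$ for all $v \notin U$ and $w(u) \in \{\lfloor m/|U|\rfloor, \lceil m/|U| \rceil\}$ for all $u \in U$; $w$ is uniform-$\alpha$ if it is uniform on some independent set of $G$ of maximum size. A graph $G$ with $n$ vertices is chordal if there is an ordering $v_1,\dots,v_n$ of $V(G)$ such that for each $i \in [n]$ the set $N_G[v_i] \setminus \{v_1,\dots,v_{i-1}\}$ is the vertex set of a clique of $G$, where $N_G[v]$ is $v$ together with its neighbours. -}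

module Defs where

open import Data.Nat using (ℕ; zero; suc; _+_; _≤_; _/_; _≡ᵇ_)
open import Data.Bool using (Bool; true; false; not; _∧_; if_then_else_)
open import Data.Fin using (Fin; toℕ; _≟_)
open import Data.Fin.Subset using (Subset; _∈_; _∉_; ∣_∣)
open import Data.Fin.Permutation using (Permutation′; _⟨$⟩ʳ_; _⟨$⟩ˡ_)
open import Data.List using (List; []; _∷_; _++_; map; concatMap; length; tabulate; allFin)
open import Data.Nat.ListAction using (sum)
open import Data.Bool.ListAction using (all)
open import Data.Product using (Σ; _×_; _,_)
open import Data.Sum using (_⊎_)
open import Relation.Binary.PropositionalEquality using (_≡_; _≢_)
open import Relation.Nullary.Decidable using (⌊_⌋)

record Graph (n : ℕ) : Set where
  field
    adj    : Fin n → Fin n → Bool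
    sym    : ∀ u v → adj u v ≡ adj v u
    irrefl : ∀ v → adj v v ≡ false
open Graph public

_~_within_ : {n : ℕ} → Fin n → Fin n → Graph n → Set
u ~ v within G = adj G u v ≡ true

InClosedNbhd : {n : ℕ} → Graph n → Fin n → Fin n → Set
InClosedNbhd G v x = (x ≡ v) ⊎ (v ~ x within G)

-- Chordal: there is an ordering v_1,…,v_n (a permutation σ, v_i = σ i,
-- position of x is σ⁻¹ x) such that for each i, N[v_i] minus {v_1..v_{i-1}}
-- (= vertices x of N[v_i] with position ≥ i) is a clique.
Chordal : {n : ℕ} → Graph n → Set
Chordal {n} G = Σ (Permutation′ n) λ σ →
  ∀ (i x y : Fin n) →
    InClosedNbhd G (σ ⟨$⟩ʳ i) x → toℕ i ≤ toℕ (σ ⟨$⟩ˡ x) →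
    InClosedNbhd G (σ ⟨$⟩ʳ i) y → toℕ i ≤ toℕ (σ ⟨$⟩ˡ y) →
    x ≢ y → x ~ y within G

IsWeighting : {n : ℕ} → ℕ → (Fin n → ℕ) → Set
IsWeighting m w = sum (tabulate w) ≡ m

Independent : {n : ℕ} → Graph n → Subset n → Set
Independent G U = ∀ u v → u ∈ U → v ∈ U → adj G u v ≡ false

MaxIndependent : {n : ℕ} → Graph n → Subset n → Set
MaxIndependent {n} G U = Independent G U × (∀ (U′ : Subset n) → Independent G U′ → ∣ U′ ∣ ≤ ∣ U ∣)

-- floor and ceiling of m / d (only used for d ≥ 1; value at d = 0 irrelevant)
floorDiv : ℕ → ℕ → ℕ
floorDiv m zero    = 0
floorDiv m (suc d) = m / suc d

ceilDiv : ℕ → ℕ → ℕ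
ceilDiv m zero    = 0
ceilDiv m (suc d) = (m + d) / suc d

UniformOn : {n : ℕ} → ℕ → (Fin n → ℕ) → Subset n → Set
UniformOn m w U =
  (∀ v → v ∉ U → w v ≡ 0) ×
  (∀ u → u ∈ U → (w u ≡ floorDiv m ∣ U ∣) ⊎ (w u ≡ ceilDiv m ∣ U ∣))

UniformAlpha : {n : ℕ} → Graph n → ℕ → (Fin n → ℕ) → Set
UniformAlpha {n} G m w = Σ (Subset n) λ U → MaxIndependent G U × UniformOn m w U

-- all sublists of length k (= all k-subsets when the list is duplicate-free)
choose : {A : Set} → ℕ → List A → List (List A)
choose zero    xs       = [] ∷ []
choose (suc k) []       = []
choose (suc k) (x ∷ xs) = map (x ∷_) (choose k xs) ++ choose (suc k) xs

pairwiseAdj : {A : Set} → (A → A → Bool) → List A → Bool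
pairwiseAdj a []       = true
pairwiseAdj a (x ∷ xs) = all (a x) xs ∧ pairwiseAdj a xs

countTrue : {A : Set} → (A → Bool) → List A → ℕ
countTrue p []       = 0
countTrue p (x ∷ xs) = if p x then suc (countTrue p xs) else countTrue p xs

record FinGraph : Set₁ where
  field
    V        : Set
    vertices : List V          -- each vertex exactly once
    adjacent : V → V → Bool

π : ℕ → FinGraph → ℕ
π k H = countTrue (pairwiseAdj (FinGraph.adjacent H)) (choose k (FinGraph.vertices H))

blowUp : {n : ℕ} → Graph n → (Fin n → ℕ) → FinGraph
blowUp {n} G w = record
  { V        = Σ (Fin n) (λ v → Fin (w v))
  ; vertices = concatMap (λ v → map (v ,_) (allFin (w v))) (allFin n)
  ; adjacent = λ { (u , i) (v , j) →
      if ⌊ u ≟ v ⌋ then not (toℕ i ≡ᵇ toℕ j) else adj G u v }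
  }

{-# OPTIONS --safe #-}
module Submission where

-- Scanning a perfect elimination ordering greedily gives an independent set I and assigns
-- to every vertex x a centre in I ∩ N[x] that does not come after x; the vertices with a
-- common centre r then lie in N[r] at or after r, so they form a clique. Colouring each
-- vertex of G(w) by the centre of its base vertex, every colour class is a clique, hence
-- π_k(G(w)) ≥ Σ_r C(x_r, k) for class sizes x_r that sum to m and vanish outside I.
-- As w′ is supported on an independent set U, every clique of G(w′) lies in one K^u, so
-- π_k(G(w′)) ≤ Σ_u C(w′ u, k). With q = ⌊m/|U|⌋, the bound
-- C(x, k) ≥ C(q, k) + (x − q) C(q, k − 1) holds for all x and is an equality for
-- x ∈ {q, q + 1}, which are the values of w′ on U; summing it over I and over U and
-- using |I| ≤ |U| = α(G) gives Σ_u C(w′ u, k) ≤ Σ_r C(x_r, k).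

open import Defs hiding (sym)
open import Data.Nat
  using (ℕ; zero; suc; _+_; _*_; _∸_; _≤_; _<_; _≤′_; ≤′-refl; ≤′-step; z≤n; s≤s⁻¹; _/_; _≡ᵇ_)
open import Data.Nat.Properties hiding (_≟_)
open import Data.Nat.Combinatorics using (_C_; nCk+nC[k+1]≡[n+1]C[k+1])
open import Data.Nat.DivMod using (/-monoˡ-≤; +-distrib-/-∣ʳ; n/n≡1)
open import Data.Nat.Divisibility using (∣-refl)
open import Data.Nat.Tactic.RingSolver using (solve-∀)
open import Data.Nat.ListAction using () renaming (sum to sumˡ)
open import Data.Bool using (Bool; true; false; T; not; _∧_; _∨_; if_then_else_)
open import Data.Bool.ListAction using (all)
open import Data.Bool.Properties using (T-≡)
open import Data.Fin using (Fin; toℕ; _≟_) renaming (zero to fzero; suc to fsuc)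
open import Data.Fin.Properties using (any?; toℕ-injective; toℕ<n)
open import Data.Fin.Permutation using (_⟨$⟩ʳ_; _⟨$⟩ˡ_; inverseʳ)
open import Data.Fin.Subset using (Subset; _∈_; _∉_; ∣_∣)
open import Data.Fin.Subset.Properties using (_∈?_)
open import Data.Vec using ([]; _∷_; here; there)
import Data.Vec as Vec
open import Data.Vec.Properties using (lookup∘tabulate; []=⇒lookup; lookup⇒[]=)
open import Data.List as List using (List; []; _∷_; _++_; map; concatMap; length; filter; filterᵇ; allFin)
open import Data.List.Properties
  using (filter-++; length-++; filter-all; filter-none; length-filter; length-map; length-tabulate; map-tabulate)
open import Data.List.Membership.Propositional using () renaming (_∈_ to _∈ₗ_)
open import Data.List.Membership.Propositional.Properties using (∈-map⁻)
open import Data.List.Relation.Unary.All as All using (All; []; _∷_)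
import Data.List.Relation.Unary.All.Properties as All
open import Data.List.Relation.Unary.AllPairs as AllPairs using (AllPairs; []; _∷_)
import Data.List.Relation.Unary.AllPairs.Properties as AllPairs
open import Data.List.Relation.Unary.Unique.Propositional using (Unique)
import Data.List.Relation.Unary.Unique.Propositional.Properties as Unique
open import Data.List.Relation.Binary.Sublist.Propositional using (_⊆_; []; _∷_; _∷ʳ_; ⊆-refl)
import Data.List.Relation.Binary.Sublist.Propositional.Properties as Sublist
open import Data.Product using (∃; Σ-syntax; _×_; _,_; proj₁)
open import Data.Sum using (_⊎_; inj₁; inj₂)
open import Data.Empty using (⊥-elim)
open import Function using (id; _∘_; Equivalence)
open import Relation.Binary.PropositionalEquality
open import Relation.Nullary using (Dec; yes; no; does; ¬_; contradiction)
open import Relation.Nullary.Decidable using (T?; _×-dec_)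
open import Relation.Unary using (Decidable)
open import Algebra.Properties.CommutativeSemigroup +-commutativeSemigroup
  using (interchange; x∙yz≈y∙xz; xy∙z≈y∙xz)
open import Algebra.Properties.CommutativeMonoid.Sum +-0-commutativeMonoid
  using (sum; ∑-distrib-+; sum-cong-≗; sum-replicate-zero)

open Equivalence using (to; from)

private variable
  A B : Set

-- Binomial coefficients

pascal : ∀ n k → suc n C suc k ≡ n C k + n C suc k
pascal n k = sym (nCk+nC[k+1]≡[n+1]C[k+1] n k)

C-monoˡ : ∀ {m n} k → m ≤ n → m C k ≤ n C k
C-monoˡ zero    _   = ≤-refl
C-monoˡ (suc k) m≤n = go (≤⇒≤′ m≤n)
  where
  go : ∀ {m n} → m ≤′ n → m C suc k ≤ n C suc k
  go ≤′-refl                    = ≤-refl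
  go {m} {suc n} (≤′-step m≤′n) = begin
    m C suc k         ≤⟨ go m≤′n ⟩
    n C suc k         ≤⟨ m≤n+m _ _ ⟩
    n C k + n C suc k ≡⟨ pascal n k ⟨
    suc n C suc k     ∎
    where open ≤-Reasoning

C-growth-lower : ∀ q d k → q C suc k + d * (q C k) ≤ (d + q) C suc k
C-growth-lower q zero    k = ≤-reflexive (+-identityʳ _)
C-growth-lower q (suc d) k = begin
  q C suc k + (q C k + d * (q C k))  ≡⟨ x∙yz≈y∙xz (q C suc k) (q C k) _ ⟩
  q C k + (q C suc k + d * (q C k))  ≤⟨ +-mono-≤ (C-monoˡ k (m≤n+m q d)) (C-growth-lower q d k) ⟩
  (d + q) C k + (d + q) C suc k      ≡⟨ pascal (d + q) k ⟨
  suc (d + q) C suc k                ∎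
  where open ≤-Reasoning

C-growth-upper : ∀ x d Q k → d + x ≤ Q → (d + x) C suc k ≤ x C suc k + d * (Q C k)
C-growth-upper x zero    Q k _     = ≤-reflexive (sym (+-identityʳ _))
C-growth-upper x (suc d) Q k d+x<Q = begin
  suc (d + x) C suc k                ≡⟨ pascal (d + x) k ⟩
  (d + x) C k + (d + x) C suc k      ≤⟨ +-mono-≤ (C-monoˡ k d+x≤Q) (C-growth-upper x d Q k d+x≤Q) ⟩
  Q C k + (x C suc k + d * (Q C k))  ≡⟨ x∙yz≈y∙xz (Q C k) (x C suc k) _ ⟩
  x C suc k + (Q C k + d * (Q C k))  ∎
  where
  open ≤-Reasoning
  d+x≤Q : d + x ≤ Q
  d+x≤Q = <⇒≤ d+x<Q

-- C(x, k+1) ≥ C(q, k+1) + (x − q) C(q, k), stated without subtraction.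
C-tangent : ∀ q x k → q C suc k + x * (q C k) ≤ x C suc k + q * (q C k)
C-tangent q x k with ≤-total q x
... | inj₁ q≤x with x ∸ q | m∸n+n≡m q≤x
...   | d | refl = begin
  q C suc k + (d + q) * (q C k)            ≡⟨ cong (q C suc k +_) (*-distribʳ-+ (q C k) d q) ⟩
  q C suc k + (d * (q C k) + q * (q C k))  ≡⟨ +-assoc (q C suc k) _ _ ⟨
  (q C suc k + d * (q C k)) + q * (q C k)  ≤⟨ +-monoˡ-≤ _ (C-growth-lower q d k) ⟩
  (d + q) C suc k + q * (q C k)            ∎
  where open ≤-Reasoning
C-tangent q x k | inj₂ x≤q with q ∸ x | m∸n+n≡m x≤q
...   | d | refl = begin
  (d + x) C suc k + x * (Q C k)            ≤⟨ +-monoˡ-≤ _ (C-growth-upper x d Q k ≤-refl) ⟩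
  (x C suc k + d * (Q C k)) + x * (Q C k)  ≡⟨ +-assoc (x C suc k) _ _ ⟩
  x C suc k + (d * (Q C k) + x * (Q C k))  ≡⟨ cong (x C suc k +_) (*-distribʳ-+ (Q C k) d x) ⟨
  x C suc k + (d + x) * (Q C k)            ∎
  where
  open ≤-Reasoning
  Q : ℕ
  Q = d + x

C-tangent-tight : ∀ q k {x} → x ≡ q ⊎ x ≡ suc q → x C suc k + q * (q C k) ≡ q C suc k + x * (q C k)
C-tangent-tight q k (inj₁ refl) = refl
C-tangent-tight q k (inj₂ refl) = begin
  suc q C suc k + q * (q C k)        ≡⟨ cong (_+ q * (q C k)) (pascal q k) ⟩
  (q C k + q C suc k) + q * (q C k)  ≡⟨ xy∙z≈y∙xz (q C k) (q C suc k) _ ⟩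
  q C suc k + (q C k + q * (q C k))  ∎
  where open ≡-Reasoning

-- Floors and ceilings

ceilDiv≡floorDiv⊎suc : ∀ m d → ceilDiv m d ≡ floorDiv m d ⊎ ceilDiv m d ≡ suc (floorDiv m d)
ceilDiv≡floorDiv⊎suc m zero    = inj₁ refl
ceilDiv≡floorDiv⊎suc m (suc d) with m≤n⇒m<n∨m≡n ceil≤1+floor
  where
  ceil≤1+floor : (m + d) / suc d ≤ suc (m / suc d)
  ceil≤1+floor = begin
    (m + d) / suc d            ≤⟨ /-monoˡ-≤ (suc d) (+-monoʳ-≤ m (n≤1+n d)) ⟩
    (m + suc d) / suc d        ≡⟨ +-distrib-/-∣ʳ m ∣-refl ⟩
    m / suc d + suc d / suc d  ≡⟨ cong (m / suc d +_) (n/n≡1 (suc d)) ⟩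
    m / suc d + 1              ≡⟨ +-comm _ 1 ⟩
    suc (m / suc d)            ∎
    where open ≤-Reasoning
... | inj₁ ceil<1+floor = inj₁ (≤-antisym (s≤s⁻¹ ceil<1+floor) (/-monoˡ-≤ (suc d) (m≤m+n m d)))
... | inj₂ ceil≡1+floor = inj₂ ceil≡1+floor

uniformOn-values : ∀ {n} m {w : Fin n → ℕ} {U : Subset n} →
  (∀ u → u ∈ U → w u ≡ floorDiv m ∣ U ∣ ⊎ w u ≡ ceilDiv m ∣ U ∣) →
  ∀ u → u ∈ U → w u ≡ floorDiv m ∣ U ∣ ⊎ w u ≡ suc (floorDiv m ∣ U ∣)
uniformOn-values m {U = U} values u u∈U with values u u∈U | ceilDiv≡floorDiv⊎suc m ∣ U ∣
... | inj₁ w≡floor | _               = inj₁ w≡floor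
... | inj₂ w≡ceil  | inj₁ ceil≡floor = inj₁ (trans w≡ceil ceil≡floor)
... | inj₂ w≡ceil  | inj₂ ceil≡suc   = inj₂ (trans w≡ceil ceil≡suc)

-- Sums over Fin n and the convexity argument

∑-zero : ∀ n → sum {n} (λ _ → 0) ≡ 0
∑-zero = sum-replicate-zero

∑-indicator : ∀ {n} (j : Fin n) a → sum (λ r → if does (j ≟ r) then a else 0) ≡ a
∑-indicator {suc n} fzero    a = trans (cong (a +_) (∑-zero n)) (+-identityʳ a)
∑-indicator {suc n} (fsuc j) a = ∑-indicator {n} j a

sum-tabulate : ∀ {n} (f : Fin n → ℕ) → sumˡ (List.tabulate f) ≡ sum f
sum-tabulate {zero}  f = refl
sum-tabulate {suc n} f = cong (f fzero +_) (sum-tabulate (f ∘ fsuc))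

weighting-sum : ∀ {n m} (w : Fin n → ℕ) → IsWeighting m w → sum w ≡ m
weighting-sum w w-weighting = trans (sym (sum-tabulate w)) w-weighting

SupportedOn : ∀ {n} → Subset n → (Fin n → ℕ) → Set
SupportedOn S x = ∀ r → r ∉ S → x r ≡ 0

private
  supportedOn-tail : ∀ {n b} {S : Subset n} {x : Fin (suc n) → ℕ} →
                     SupportedOn (b ∷ S) x → SupportedOn S (x ∘ fsuc)
  supportedOn-tail supp r r∉S = supp (fsuc r) λ { (there r∈S) → r∉S r∈S }

∑C-tangent : ∀ {n} (S : Subset n) (x : Fin n → ℕ) q k → SupportedOn S x →
  ∣ S ∣ * (q C suc k) + sum x * (q C k) ≤ sum (λ r → x r C suc k) + ∣ S ∣ * (q * (q C k))
∑C-tangent []          x q k supp = ≤-refl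
∑C-tangent {suc n} (true ∷ S) x q k supp = begin
  (c + ∣ S ∣ * c) + (x₀ + sum x′) * s
    ≡⟨ cong ((c + ∣ S ∣ * c) +_) (*-distribʳ-+ s x₀ _) ⟩
  (c + ∣ S ∣ * c) + (x₀ * s + sum x′ * s)
    ≡⟨ interchange c (∣ S ∣ * c) (x₀ * s) (sum x′ * s) ⟩
  (c + x₀ * s) + (∣ S ∣ * c + sum x′ * s)
    ≤⟨ +-mono-≤ (C-tangent q x₀ k) (∑C-tangent S x′ q k (supportedOn-tail supp)) ⟩
  (x₀ C suc k + e) + (sum (λ r → x′ r C suc k) + ∣ S ∣ * e)
    ≡⟨ interchange (x₀ C suc k) e (sum (λ r → x′ r C suc k)) (∣ S ∣ * e) ⟩
  (x₀ C suc k + sum (λ r → x′ r C suc k)) + (e + ∣ S ∣ * e) ∎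
  where
  open ≤-Reasoning
  s c e x₀ : ℕ
  s = q C k
  c = q C suc k
  e = q * s
  x₀ = x fzero
  x′ : Fin n → ℕ
  x′ = x ∘ fsuc
∑C-tangent (false ∷ S) x q k supp rewrite supp fzero (λ ()) =
  ∑C-tangent S (x ∘ fsuc) q k (supportedOn-tail supp)

∑C-uniform : ∀ {n} (S : Subset n) (y : Fin n → ℕ) q k → SupportedOn S y →
  (∀ r → r ∈ S → y r ≡ q ⊎ y r ≡ suc q) →
  sum (λ r → y r C suc k) + ∣ S ∣ * (q * (q C k)) ≡ ∣ S ∣ * (q C suc k) + sum y * (q C k)
∑C-uniform []          y q k supp unif = refl
∑C-uniform {suc n} (true ∷ S) y q k supp unif = begin
  (y₀ C suc k + sum (λ r → y′ r C suc k)) + (e + ∣ S ∣ * e)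
    ≡⟨ interchange (y₀ C suc k) (sum (λ r → y′ r C suc k)) e (∣ S ∣ * e) ⟩
  (y₀ C suc k + e) + (sum (λ r → y′ r C suc k) + ∣ S ∣ * e)
    ≡⟨ cong₂ _+_ (C-tangent-tight q k (unif fzero here)) rest ⟩
  (c + y₀ * s) + (∣ S ∣ * c + sum y′ * s)
    ≡⟨ interchange c (∣ S ∣ * c) (y₀ * s) (sum y′ * s) ⟨
  (c + ∣ S ∣ * c) + (y₀ * s + sum y′ * s)
    ≡⟨ cong ((c + ∣ S ∣ * c) +_) (*-distribʳ-+ s y₀ _) ⟨
  (c + ∣ S ∣ * c) + (y₀ + sum y′) * s ∎
  where
  open ≡-Reasoning
  s c e y₀ : ℕ
  s = q C k
  c = q C suc k
  e = q * s
  y₀ = y fzero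
  y′ : Fin n → ℕ
  y′ = y ∘ fsuc
  rest : sum (λ r → y′ r C suc k) + ∣ S ∣ * e ≡ ∣ S ∣ * c + sum y′ * s
  rest = ∑C-uniform S y′ q k (supportedOn-tail supp) (λ r r∈S → unif (fsuc r) (there r∈S))
∑C-uniform (false ∷ S) y q k supp unif rewrite supp fzero (λ ()) =
  ∑C-uniform S (y ∘ fsuc) q k (supportedOn-tail supp) (λ r r∈S → unif (fsuc r) (there r∈S))

∑C-minimisedByUniform : ∀ {n} (S T : Subset n) (x y : Fin n → ℕ) q k →
  ∣ S ∣ ≤ ∣ T ∣ → SupportedOn S x → SupportedOn T y →
  (∀ r → r ∈ T → y r ≡ q ⊎ y r ≡ suc q) → sum x ≡ sum y →
  sum (λ r → y r C suc k) ≤ sum (λ r → x r C suc k)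
∑C-minimisedByUniform S T x y q k ∣S∣≤∣T∣ suppˣ suppʸ unif ∑x≡∑y =
  +-cancelʳ-≤ (∣ T ∣ * e) Y X (begin
    Y + ∣ T ∣ * e            ≡⟨ ∑C-uniform T y q k suppʸ unif ⟩
    ∣ T ∣ * c + M            ≡⟨ cong (λ t → t * c + M) (m∸n+n≡m ∣S∣≤∣T∣) ⟨
    (d + ∣ S ∣) * c + M      ≡⟨ regroup d ∣ S ∣ c M ⟩
    d * c + (∣ S ∣ * c + M)  ≤⟨ +-mono-≤ (*-monoʳ-≤ d c≤e) lower ⟩
    d * e + (X + ∣ S ∣ * e)  ≡⟨ regroup′ d ∣ S ∣ e X ⟩
    X + (d + ∣ S ∣) * e      ≡⟨ cong (λ t → X + t * e) (m∸n+n≡m ∣S∣≤∣T∣) ⟩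
    X + ∣ T ∣ * e            ∎)
  where
  open ≤-Reasoning
  c e d X Y M : ℕ
  c = q C suc k
  e = q * (q C k)
  d = ∣ T ∣ ∸ ∣ S ∣
  X = sum (λ r → x r C suc k)
  Y = sum (λ r → y r C suc k)
  M = sum y * (q C k)
  c≤e : c ≤ e
  c≤e = ≤-trans (m≤m+n c 0) (C-tangent q 0 k)
  lower : ∣ S ∣ * c + M ≤ X + ∣ S ∣ * e
  lower = subst (λ t → ∣ S ∣ * c + t * (q C k) ≤ X + ∣ S ∣ * e) ∑x≡∑y (∑C-tangent S x q k suppˣ)
  regroup : ∀ d a c M → (d + a) * c + M ≡ d * c + (a * c + M)
  regroup = solve-∀
  regroup′ : ∀ d a e X → d * e + (X + a * e) ≡ X + (d + a) * e
  regroup′ = solve-∀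

-- Counting cliques in a list

countTrue-cong : ∀ {p q : B → Bool} → (∀ x → p x ≡ q x) → ∀ xs → countTrue p xs ≡ countTrue q xs
countTrue-cong p≗q []       = refl
countTrue-cong {q = q} p≗q (x ∷ xs) rewrite p≗q x =
  cong (λ c → if q x then suc c else c) (countTrue-cong p≗q xs)

countTrue-map : ∀ (p : B → Bool) (f : A → B) xs → countTrue p (map f xs) ≡ countTrue (p ∘ f) xs
countTrue-map p f []       = refl
countTrue-map p f (x ∷ xs) with p (f x)
... | true  = cong suc (countTrue-map p f xs)
... | false = countTrue-map p f xs

countTrue-++ : ∀ (p : B → Bool) xs ys → countTrue p (xs ++ ys) ≡ countTrue p xs + countTrue p ys
countTrue-++ p []       ys = refl
countTrue-++ p (x ∷ xs) ys with p x
... | true  = cong suc (countTrue-++ p xs ys)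
... | false = countTrue-++ p xs ys

countTrue-false : ∀ (xs : List B) → countTrue (λ _ → false) xs ≡ 0
countTrue-false []       = refl
countTrue-false (x ∷ xs) = countTrue-false xs

countTrue-choose-∷ : ∀ (P : List B → Bool) k y ys →
  countTrue P (choose (suc k) (y ∷ ys)) ≡ countTrue (P ∘ (y ∷_)) (choose k ys) + countTrue P (choose (suc k) ys)
countTrue-choose-∷ P k y ys = begin
  countTrue P (map (y ∷_) (choose k ys) ++ choose (suc k) ys)
    ≡⟨ countTrue-++ P (map (y ∷_) (choose k ys)) _ ⟩
  countTrue P (map (y ∷_) (choose k ys)) + countTrue P (choose (suc k) ys)
    ≡⟨ cong (_+ _) (countTrue-map P (y ∷_) (choose k ys)) ⟩
  countTrue (P ∘ (y ∷_)) (choose k ys) + countTrue P (choose (suc k) ys) ∎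
  where open ≡-Reasoning

countTrue-choose-filterᵇ : ∀ {B : Set} (q : B → Bool) (P : List B → Bool) k xs →
  countTrue (λ ys → all q ys ∧ P ys) (choose k xs) ≡ countTrue P (choose k (filterᵇ q xs))
countTrue-choose-filterᵇ q P zero    xs       = refl
countTrue-choose-filterᵇ q P (suc k) []       = refl
countTrue-choose-filterᵇ {B} q P (suc k) (y ∷ ys) with q y in qy
... | true  = begin
  countTrue Q (choose (suc k) (y ∷ ys))
    ≡⟨ countTrue-choose-∷ Q k y ys ⟩
  countTrue (Q ∘ (y ∷_)) (choose k ys) + countTrue Q (choose (suc k) ys)
    ≡⟨ cong (_+ countTrue Q (choose (suc k) ys)) (countTrue-cong (head-with qy) (choose k ys)) ⟩
  countTrue (λ zs → all q zs ∧ P (y ∷ zs)) (choose k ys) + countTrue Q (choose (suc k) ys)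
    ≡⟨ cong₂ _+_ (countTrue-choose-filterᵇ q (P ∘ (y ∷_)) k ys) (countTrue-choose-filterᵇ q P (suc k) ys) ⟩
  countTrue (P ∘ (y ∷_)) (choose k ys′) + countTrue P (choose (suc k) ys′)
    ≡⟨ countTrue-choose-∷ P k y ys′ ⟨
  countTrue P (choose (suc k) (y ∷ ys′)) ∎
  where
  open ≡-Reasoning
  Q : List B → Bool
  Q zs = all q zs ∧ P zs
  ys′ : List B
  ys′ = filterᵇ q ys
  head-with : ∀ {b} → q y ≡ b → ∀ zs → Q (y ∷ zs) ≡ (b ∧ all q zs) ∧ P (y ∷ zs)
  head-with qy zs = cong (λ b → (b ∧ all q zs) ∧ P (y ∷ zs)) qy
... | false = begin
  countTrue Q (choose (suc k) (y ∷ ys))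
    ≡⟨ countTrue-choose-∷ Q k y ys ⟩
  countTrue (Q ∘ (y ∷_)) (choose k ys) + countTrue Q (choose (suc k) ys)
    ≡⟨ cong₂ _+_ (trans (countTrue-cong (head-with qy) (choose k ys)) (countTrue-false (choose k ys)))
                 (countTrue-choose-filterᵇ q P (suc k) ys) ⟩
  countTrue P (choose (suc k) (filterᵇ q ys)) ∎
  where
  open ≡-Reasoning
  Q : List B → Bool
  Q zs = all q zs ∧ P zs
  head-with : ∀ {b} → q y ≡ b → ∀ zs → Q (y ∷ zs) ≡ (b ∧ all q zs) ∧ P (y ∷ zs)
  head-with qy zs = cong (λ b → (b ∧ all q zs) ∧ P (y ∷ zs)) qy

module _ (adj : A → A → Bool) where

  cliqueCount : ℕ → List A → ℕ
  cliqueCount k xs = countTrue (pairwiseAdj adj) (choose k xs)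

  cliqueCount-∷ : ∀ k x xs →
    cliqueCount (suc k) (x ∷ xs) ≡ cliqueCount k (filterᵇ (adj x) xs) + cliqueCount (suc k) xs
  cliqueCount-∷ k x xs =
    trans (countTrue-choose-∷ (pairwiseAdj adj) k x xs)
          (cong (_+ cliqueCount (suc k) xs) (countTrue-choose-filterᵇ (adj x) (pairwiseAdj adj) k xs))

  cliqueCount-mono : ∀ k {xs ys} → xs ⊆ ys → cliqueCount k xs ≤ cliqueCount k ys
  cliqueCount-mono zero    _             = ≤-refl
  cliqueCount-mono (suc k) []            = ≤-refl
  cliqueCount-mono (suc k) (y ∷ʳ xs⊆ys) =
    ≤-trans (cliqueCount-mono (suc k) xs⊆ys) (≤-trans (m≤n+m _ _) (≤-reflexive (sym (cliqueCount-∷ k y _))))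
  cliqueCount-mono (suc k) {x ∷ xs} {x ∷ ys} (refl ∷ xs⊆ys) = begin
    cliqueCount (suc k) (x ∷ xs)
      ≡⟨ cliqueCount-∷ k x xs ⟩
    cliqueCount k (filterᵇ (adj x) xs) + cliqueCount (suc k) xs
      ≤⟨ +-mono-≤ (cliqueCount-mono k nbrs⊆nbrs) (cliqueCount-mono (suc k) xs⊆ys) ⟩
    cliqueCount k (filterᵇ (adj x) ys) + cliqueCount (suc k) ys
      ≡⟨ cliqueCount-∷ k x ys ⟨
    cliqueCount (suc k) (x ∷ ys) ∎
    where
    open ≤-Reasoning
    nbrs⊆nbrs : filterᵇ (adj x) xs ⊆ filterᵇ (adj x) ys
    nbrs⊆nbrs = Sublist.filter⁺ (T? ∘ adj x) (T? ∘ adj x) (λ { refl → id }) xs⊆ys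

  cliqueCount≤C : ∀ k xs → cliqueCount k xs ≤ length xs C k
  cliqueCount≤C zero    xs       = ≤-refl
  cliqueCount≤C (suc k) []       = ≤-refl
  cliqueCount≤C (suc k) (x ∷ xs) = begin
    cliqueCount (suc k) (x ∷ xs)
      ≡⟨ cliqueCount-∷ k x xs ⟩
    cliqueCount k (filterᵇ (adj x) xs) + cliqueCount (suc k) xs
      ≤⟨ +-mono-≤ nbrs≤ (cliqueCount≤C (suc k) xs) ⟩
    length xs C k + length xs C suc k
      ≡⟨ pascal (length xs) k ⟨
    suc (length xs) C suc k ∎
    where
    open ≤-Reasoning
    nbrs≤ : cliqueCount k (filterᵇ (adj x) xs) ≤ length xs C k
    nbrs≤ = ≤-trans (cliqueCount≤C k _) (C-monoˡ k (length-filter (T? ∘ adj x) xs))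

  clique⇒cliqueCount≡C : ∀ k {xs} → AllPairs (λ x y → T (adj x y)) xs → cliqueCount k xs ≡ length xs C k
  clique⇒cliqueCount≡C zero    _                         = refl
  clique⇒cliqueCount≡C (suc k) []                        = refl
  clique⇒cliqueCount≡C (suc k) {x ∷ xs} (x~xs ∷ clique) = begin
    cliqueCount (suc k) (x ∷ xs)
      ≡⟨ cliqueCount-∷ k x xs ⟩
    cliqueCount k (filterᵇ (adj x) xs) + cliqueCount (suc k) xs
      ≡⟨ cong (λ ys → cliqueCount k ys + _) (filter-all (T? ∘ adj x) x~xs) ⟩
    cliqueCount k xs + cliqueCount (suc k) xs
      ≡⟨ cong₂ _+_ (clique⇒cliqueCount≡C k clique) (clique⇒cliqueCount≡C (suc k) clique) ⟩
    length xs C k + length xs C suc k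
      ≡⟨ pascal (length xs) k ⟨
    suc (length xs) C suc k ∎
    where open ≡-Reasoning

-- Colour classes

filter-⊆-filter : ∀ {P Q : A → Set} (P? : Decidable P) (Q? : Decidable Q) {xs} →
  All (λ y → P y → Q y) xs → filter P? xs ⊆ filter Q? xs
filter-⊆-filter P? Q? [] = []
filter-⊆-filter P? Q? {y ∷ ys} (P⇒Q ∷ rest) with P? y | Q? y
... | yes _  | yes _  = refl ∷ filter-⊆-filter P? Q? rest
... | yes Py | no ¬Qy = ⊥-elim (¬Qy (P⇒Q Py))
... | no _   | yes _  = y ∷ʳ filter-⊆-filter P? Q? rest
... | no _   | no _   = filter-⊆-filter P? Q? rest

module _ {n} (colour : A → Fin n) where

  colourClass : Fin n → List A → List A
  colourClass r = filter (λ y → colour y ≟ r)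

  ∑C-colourClass : ℕ → List A → ℕ
  ∑C-colourClass k xs = sum (λ r → length (colourClass r xs) C k)

  ∑-length-colourClass : ∀ xs → sum (λ r → length (colourClass r xs)) ≡ length xs
  ∑-length-colourClass []       = ∑-zero n
  ∑-length-colourClass (x ∷ xs) = begin
    sum (λ r → length (colourClass r (x ∷ xs)))
      ≡⟨ sum-cong-≗ step ⟩
    sum (λ r → δ r + length (colourClass r xs))
      ≡⟨ ∑-distrib-+ δ (λ r → length (colourClass r xs)) ⟩
    sum δ + sum (λ r → length (colourClass r xs))
      ≡⟨ cong₂ _+_ (∑-indicator (colour x) 1) (∑-length-colourClass xs) ⟩
    suc (length xs) ∎
    where
    open ≡-Reasoning
    δ : Fin n → ℕ
    δ r = if does (colour x ≟ r) then 1 else 0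
    step : ∀ r → length (colourClass r (x ∷ xs)) ≡ δ r + length (colourClass r xs)
    step r with colour x ≟ r
    ... | yes _ = refl
    ... | no _  = refl

  ∑C-colourClass-∷ : ∀ k x xs →
    ∑C-colourClass (suc k) (x ∷ xs) ≡ length (colourClass (colour x) xs) C k + ∑C-colourClass (suc k) xs
  ∑C-colourClass-∷ k x xs = begin
    ∑C-colourClass (suc k) (x ∷ xs)
      ≡⟨ sum-cong-≗ step ⟩
    sum (λ r → δ r + length (colourClass r xs) C suc k)
      ≡⟨ ∑-distrib-+ δ (λ r → length (colourClass r xs) C suc k) ⟩
    sum δ + ∑C-colourClass (suc k) xs
      ≡⟨ cong (_+ _) (∑-indicator (colour x) a) ⟩
    a + ∑C-colourClass (suc k) xs ∎
    where
    open ≡-Reasoning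
    a : ℕ
    a = length (colourClass (colour x) xs) C k
    δ : Fin n → ℕ
    δ r = if does (colour x ≟ r) then a else 0
    step : ∀ r → length (colourClass r (x ∷ xs)) C suc k ≡ δ r + length (colourClass r xs) C suc k
    step r with colour x ≟ r
    ... | yes refl = pascal _ k
    ... | no _     = refl

  colourClass-clique : ∀ (adj : A → A → Bool) r {xs} →
    AllPairs (λ x y → colour x ≡ colour y → T (adj x y)) xs →
    AllPairs (λ x y → T (adj x y)) (colourClass r xs)
  colourClass-clique adj r [] = []
  colourClass-clique adj r {y ∷ ys} (y~ys ∷ rest) with colour y ≟ r
  ... | yes cy≡r = All.zipWith (λ (y~z , cz≡r) → y~z (trans cy≡r (sym cz≡r)))
                     (All.filter⁺ (λ z → colour z ≟ r) y~ys , All.all-filter (λ z → colour z ≟ r) ys)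
                   ∷ colourClass-clique adj r rest
  ... | no _     = colourClass-clique adj r rest

  ∑C-colourClass≤cliqueCount : ∀ (adj : A → A → Bool) k {xs} →
    AllPairs (λ x y → colour x ≡ colour y → T (adj x y)) xs →
    ∑C-colourClass (suc k) xs ≤ cliqueCount adj (suc k) xs
  ∑C-colourClass≤cliqueCount adj k []                    = ≤-reflexive (∑-zero n)
  ∑C-colourClass≤cliqueCount adj k {x ∷ xs} (x~xs ∷ rest) = begin
    ∑C-colourClass (suc k) (x ∷ xs)
      ≡⟨ ∑C-colourClass-∷ k x xs ⟩
    length class C k + ∑C-colourClass (suc k) xs
      ≡⟨ cong (_+ _) (clique⇒cliqueCount≡C adj k (colourClass-clique adj (colour x) rest)) ⟨
    cliqueCount adj k class + ∑C-colourClass (suc k) xs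
      ≤⟨ +-mono-≤ (cliqueCount-mono adj k class⊆nbrs) (∑C-colourClass≤cliqueCount adj k rest) ⟩
    cliqueCount adj k (filterᵇ (adj x) xs) + cliqueCount adj (suc k) xs
      ≡⟨ cliqueCount-∷ adj k x xs ⟨
    cliqueCount adj (suc k) (x ∷ xs) ∎
    where
    open ≤-Reasoning
    class : List A
    class = colourClass (colour x) xs
    class⊆nbrs : class ⊆ filterᵇ (adj x) xs
    class⊆nbrs = filter-⊆-filter (λ y → colour y ≟ colour x) (T? ∘ adj x)
                   (All.map (λ x~y cy≡cx → x~y (sym cy≡cx)) x~xs)

  cliqueCount≤∑C-colourClass : ∀ (adj : A → A → Bool) k xs →
    (∀ x y → T (adj x y) → colour x ≡ colour y) → cliqueCount adj (suc k) xs ≤ ∑C-colourClass (suc k) xs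
  cliqueCount≤∑C-colourClass adj k []       adj⇒same = z≤n
  cliqueCount≤∑C-colourClass adj k (x ∷ xs) adj⇒same = begin
    cliqueCount adj (suc k) (x ∷ xs)
      ≡⟨ cliqueCount-∷ adj k x xs ⟩
    cliqueCount adj k (filterᵇ (adj x) xs) + cliqueCount adj (suc k) xs
      ≤⟨ +-mono-≤ (cliqueCount-mono adj k nbrs⊆class) (cliqueCount≤∑C-colourClass adj k xs adj⇒same) ⟩
    cliqueCount adj k class + ∑C-colourClass (suc k) xs
      ≤⟨ +-monoˡ-≤ _ (cliqueCount≤C adj k class) ⟩
    length class C k + ∑C-colourClass (suc k) xs
      ≡⟨ ∑C-colourClass-∷ k x xs ⟨
    ∑C-colourClass (suc k) (x ∷ xs) ∎
    where
    open ≤-Reasoning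
    class : List A
    class = colourClass (colour x) xs
    nbrs⊆class : filterᵇ (adj x) xs ⊆ class
    nbrs⊆class = Sublist.filter⁺ (T? ∘ adj x) (λ y → colour y ≟ colour x)
                   (λ { refl x~y → sym (adj⇒same x _ x~y) }) (⊆-refl {x = xs})

-- Clique covers of chordal graphs

record CliqueCover {n} (G : Graph n) : Set where
  field
    centres     : Subset n
    independent : Independent G centres
    centre      : Fin n → Fin n
    centre∈     : ∀ v → centre v ∈ centres
    clique      : ∀ u v → u ≢ v → centre u ≡ centre v → u ~ v within G

sameCentre⇒≡⊎adjacent : ∀ {n} {G : Graph n} (cover : CliqueCover G) u v →
  CliqueCover.centre cover u ≡ CliqueCover.centre cover v → u ≡ v ⊎ u ~ v within G
sameCentre⇒≡⊎adjacent cover u v same with u ≟ v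
... | yes u≡v = inj₁ u≡v
... | no u≢v  = inj₂ (CliqueCover.clique cover u v u≢v same)

module GreedyIndependentSet {n} (G : Graph n) (rank : Fin n → ℕ)
                            (rank-injective : ∀ {x y} → rank x ≡ rank y → x ≡ y) where

  -- chosen t is the greedy independent set after scanning the ranks below t: the vertex
  -- of rank t is added unless it already has a chosen neighbour.
  mutual
    chosen : ℕ → Fin n → Bool
    chosen zero    x = false
    chosen (suc t) x = chosen t x ∨ ((rank x ≡ᵇ t) ∧ not (does (chosenNeighbour? t x)))

    ChosenNeighbour : ℕ → Fin n → Set
    ChosenNeighbour t x = ∃ λ s → T (chosen t s) × T (adj G s x)

    chosenNeighbour? : ∀ t x → Dec (ChosenNeighbour t x)
    chosenNeighbour? t x = any? λ s → T? (chosen t s) ×-dec T? (adj G s x)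

  chosen-suc⁺ : ∀ t x → T (chosen t x) → T (chosen (suc t) x)
  chosen-suc⁺ t x c with chosen t x
  ... | true = _

  chosen-new : ∀ t x → rank x ≡ t → ¬ ChosenNeighbour t x → T (chosen (suc t) x)
  chosen-new t x r≡t ¬nbr with chosen t x | rank x ≡ᵇ t | ≡⇒≡ᵇ (rank x) t r≡t | chosenNeighbour? t x
  ... | true  | _    | _ | _       = _
  ... | false | true | _ | no _    = _
  ... | false | true | _ | yes nbr = ¬nbr nbr

  chosen-suc⁻ : ∀ t x → T (chosen (suc t) x) → T (chosen t x) ⊎ (rank x ≡ t × ¬ ChosenNeighbour t x)
  chosen-suc⁻ t x c with chosen t x | rank x ≡ᵇ t in r≡ᵇt | chosenNeighbour? t x
  ... | true  | _    | _       = inj₁ _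
  ... | false | true | no ¬nbr = inj₂ (≡ᵇ⇒≡ (rank x) t (from T-≡ r≡ᵇt) , ¬nbr)

  chosen⇒rank< : ∀ t x → T (chosen t x) → rank x < t
  chosen⇒rank< (suc t) x c with chosen-suc⁻ t x c
  ... | inj₁ c′         = m<n⇒m<1+n (chosen⇒rank< t x c′)
  ... | inj₂ (refl , _) = n<1+n t

  chosen-notAdjacent : ∀ t u v → T (chosen t u) → ¬ ChosenNeighbour t v → adj G u v ≡ false
  chosen-notAdjacent t u v cu ¬nbr with adj G u v in u~v
  ... | false = refl
  ... | true  = ⊥-elim (¬nbr (u , cu , from T-≡ u~v))

  chosen-independent : ∀ t u v → T (chosen t u) → T (chosen t v) → adj G u v ≡ false
  chosen-independent (suc t) u v cu cv with chosen-suc⁻ t u cu | chosen-suc⁻ t v cv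
  ... | inj₁ cu′        | inj₁ cv′        = chosen-independent t u v cu′ cv′
  ... | inj₁ cu′        | inj₂ (_ , ¬nbr) = chosen-notAdjacent t u v cu′ ¬nbr
  ... | inj₂ (_ , ¬nbr) | inj₁ cv′        = trans (Graph.sym G u v) (chosen-notAdjacent t v u cv′ ¬nbr)
  ... | inj₂ (ru≡t , _) | inj₂ (rv≡t , _) rewrite rank-injective (trans ru≡t (sym rv≡t)) = irrefl G v

  unchosen⇒chosenNeighbour : ∀ t x → rank x < t → ¬ T (chosen t x) →
    ∃ λ s → T (chosen t s) × T (adj G s x) × rank s < rank x
  unchosen⇒chosenNeighbour (suc t) x r<1+t ¬cx with m<1+n⇒m<n∨m≡n r<1+t
  ... | inj₁ r<t with unchosen⇒chosenNeighbour t x r<t (¬cx ∘ chosen-suc⁺ t x)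
  ...   | s , cs , s~x , s<x = s , chosen-suc⁺ t s cs , s~x , s<x
  unchosen⇒chosenNeighbour (suc t) x r<1+t ¬cx | inj₂ r≡t = fromDec (chosenNeighbour? t x)
    where
    fromDec : Dec (ChosenNeighbour t x) → ∃ λ s → T (chosen (suc t) s) × T (adj G s x) × rank s < rank x
    fromDec (yes (s , cs , s~x)) =
      s , chosen-suc⁺ t s cs , s~x , subst (rank s <_) (sym r≡t) (chosen⇒rank< t s cs)
    fromDec (no ¬nbr)            = contradiction (chosen-new t x r≡t ¬nbr) ¬cx

chordal⇒cliqueCover : ∀ {n} (G : Graph n) → Chordal G → CliqueCover G
chordal⇒cliqueCover {n} G (σ , peo) = record
  { centres     = centres
  ; independent = λ u v u∈ v∈ → chosen-independent n u v (∈centres⁻ u∈) (∈centres⁻ v∈)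
  ; centre      = proj₁ ∘ centreOf
  ; centre∈     = λ x → let (_ , cr , _) = centreOf x in ∈centres⁺ cr
  ; clique      = clique
  }
  where
  rank : Fin n → ℕ
  rank x = toℕ (σ ⟨$⟩ˡ x)

  rank-injective : ∀ {x y} → rank x ≡ rank y → x ≡ y
  rank-injective rx≡ry =
    trans (sym (inverseʳ σ)) (trans (cong (σ ⟨$⟩ʳ_) (toℕ-injective rx≡ry)) (inverseʳ σ))

  open GreedyIndependentSet G rank rank-injective

  centres : Subset n
  centres = Vec.tabulate (chosen n)

  ∈centres⁻ : ∀ {x} → x ∈ centres → T (chosen n x)
  ∈centres⁻ {x} x∈ = from T-≡ (trans (sym (lookup∘tabulate (chosen n) x)) ([]=⇒lookup x∈))

  ∈centres⁺ : ∀ {x} → T (chosen n x) → x ∈ centres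
  ∈centres⁺ {x} cx = lookup⇒[]= x centres (trans (lookup∘tabulate (chosen n) x) (to T-≡ cx))

  Centre : Fin n → Set
  Centre x = Σ[ r ∈ Fin n ] T (chosen n r) × InClosedNbhd G r x × rank r ≤ rank x

  centreOf : ∀ x → Centre x
  centreOf x with T? (chosen n x)
  ... | yes cx  = x , cx , inj₁ refl , ≤-refl
  ... | no ¬cx with unchosen⇒chosenNeighbour n x (toℕ<n (σ ⟨$⟩ˡ x)) ¬cx
  ...   | s , cs , s~x , s<x = s , cs , inj₂ (to T-≡ s~x) , <⇒≤ s<x

  clique : ∀ u v → u ≢ v → proj₁ (centreOf u) ≡ proj₁ (centreOf v) → u ~ v within G
  clique u v u≢v = sharedCentre (centreOf u) (centreOf v)
    where
    sharedCentre : (cu : Centre u) (cv : Centre v) → proj₁ cu ≡ proj₁ cv → u ~ v within G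
    sharedCentre (r , _ , r∋u , r≤u) (.r , _ , r∋v , r≤v) refl =
      peo (σ ⟨$⟩ˡ r) u v (nbhd r∋u) r≤u (nbhd r∋v) r≤v u≢v
      where
      nbhd : ∀ {x} → InClosedNbhd G r x → InClosedNbhd G (σ ⟨$⟩ʳ (σ ⟨$⟩ˡ r)) x
      nbhd = subst (λ c → InClosedNbhd G c _) (sym (inverseʳ σ))
-- Blow-ups

length-filter-concatMap : ∀ {P : B → Set} (P? : Decidable P) (f : A → List B) xs →
  length (filter P? (concatMap f xs)) ≡ sumˡ (map (length ∘ filter P? ∘ f) xs)
length-filter-concatMap P? f []       = refl
length-filter-concatMap P? f (x ∷ xs) = begin
  length (filter P? (f x ++ concatMap f xs))
    ≡⟨ cong length (filter-++ P? (f x) (concatMap f xs)) ⟩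
  length (filter P? (f x) ++ filter P? (concatMap f xs))
    ≡⟨ length-++ (filter P? (f x)) ⟩
  length (filter P? (f x)) + length (filter P? (concatMap f xs))
    ≡⟨ cong (length (filter P? (f x)) +_) (length-filter-concatMap P? f xs) ⟩
  sumˡ (map (length ∘ filter P? ∘ f) (x ∷ xs)) ∎
  where open ≡-Reasoning

module _ {n} (G : Graph n) (w : Fin n → ℕ) where

  open FinGraph (blowUp G w) using (V; vertices; adjacent)

  fibre : Fin n → List V
  fibre v = map (v ,_) (allFin (w v))

  ∈fibre⇒proj₁ : ∀ {v y} → y ∈ₗ fibre v → proj₁ y ≡ v
  ∈fibre⇒proj₁ {v} y∈ with ∈-map⁻ (v ,_) y∈
  ... | _ , _ , refl = refl

  fibre-proj₁ : ∀ v → All (λ y → proj₁ y ≡ v) (fibre v)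
  fibre-proj₁ v = All.tabulate ∈fibre⇒proj₁

  length-fibre : ∀ v → length (fibre v) ≡ w v
  length-fibre v = trans (length-map _ (allFin (w v))) (length-tabulate id)

  vertices-unique : Unique vertices
  vertices-unique = Unique.concat⁺
    (All.map⁺ (All.tabulate⁺ λ v → Unique.map⁺ fibre-injective (Unique.allFin⁺ (w v))))
    (AllPairs.map⁺ (AllPairs.tabulate⁺ λ u≢v (y∈u , y∈v) →
      u≢v (trans (sym (∈fibre⇒proj₁ y∈u)) (∈fibre⇒proj₁ y∈v))))
    where
    fibre-injective : ∀ {v} {i j : Fin (w v)} → _≡_ {A = V} (v , i) (v , j) → i ≡ j
    fibre-injective refl = refl

  length-colourClass-fibre : ∀ r v →
    length (colourClass proj₁ r (fibre v)) ≡ (if does (r ≟ v) then w r else 0)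
  length-colourClass-fibre r v with r ≟ v
  ... | yes refl = trans (cong length (filter-all (λ y → proj₁ y ≟ r) (fibre-proj₁ r))) (length-fibre r)
  ... | no r≢v   = cong length (filter-none (λ y → proj₁ y ≟ r)
                     (All.map (λ y↦v y↦r → r≢v (trans (sym y↦r) y↦v)) (fibre-proj₁ v)))

  length-colourClass-proj₁ : ∀ r → length (colourClass proj₁ r vertices) ≡ w r
  length-colourClass-proj₁ r = begin
    length (colourClass proj₁ r vertices)
      ≡⟨ length-filter-concatMap (λ y → proj₁ y ≟ r) fibre (allFin n) ⟩
    sumˡ (map fibreCount (allFin n))
      ≡⟨ cong sumˡ (map-tabulate id fibreCount) ⟩
    sumˡ (List.tabulate fibreCount)
      ≡⟨ sum-tabulate fibreCount ⟩
    sum fibreCount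
      ≡⟨ sum-cong-≗ (length-colourClass-fibre r) ⟩
    sum (λ v → if does (r ≟ v) then w r else 0)
      ≡⟨ ∑-indicator r (w r) ⟩
    w r ∎
    where
    open ≡-Reasoning
    fibreCount : Fin n → ℕ
    fibreCount v = length (colourClass proj₁ r (fibre v))

  length-vertices : length vertices ≡ sum w
  length-vertices = trans (sym (∑-length-colourClass proj₁ vertices)) (sum-cong-≗ length-colourClass-proj₁)

  adjacent⁺ : ∀ {u v} {i : Fin (w u)} {j : Fin (w v)} → (u , i) ≢ (v , j) → u ≡ v ⊎ u ~ v within G →
    T (adjacent (u , i) (v , j))
  adjacent⁺ {u} {v} {i} {j} ui≢vj u≡v⊎u~v with u ≟ v | u≡v⊎u~v
  ... | yes refl | _        = distinct (toℕ i ≡ᵇ toℕ j) refl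
    where
    distinct : ∀ b → (toℕ i ≡ᵇ toℕ j) ≡ b → T (not b)
    distinct false _  = _
    distinct true  eq =
      contradiction (cong (u ,_) (toℕ-injective (≡ᵇ⇒≡ (toℕ i) (toℕ j) (from T-≡ eq)))) ui≢vj
  ... | no u≢v   | inj₁ u≡v = contradiction u≡v u≢v
  ... | no _     | inj₂ u~v = from T-≡ u~v

  adjacent⁻ : ∀ {u v} {i : Fin (w u)} {j : Fin (w v)} → T (adjacent (u , i) (v , j)) →
    u ≡ v ⊎ u ~ v within G
  adjacent⁻ {u} {v} ui~vj with u ≟ v
  ... | yes u≡v = inj₁ u≡v
  ... | no _    = inj₂ (to T-≡ ui~vj)

  π-blowUp≤∑C : ∀ {U} → Independent G U → SupportedOn U w → ∀ k →
    π (suc k) (blowUp G w) ≤ sum (λ r → w r C suc k)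
  π-blowUp≤∑C {U} U-independent U-support k = begin
    π (suc k) (blowUp G w)
      ≤⟨ cliqueCount≤∑C-colourClass proj₁ adjacent k vertices adjacent⇒sameVertex ⟩
    ∑C-colourClass proj₁ (suc k) vertices
      ≡⟨ sum-cong-≗ (λ r → cong (_C suc k) (length-colourClass-proj₁ r)) ⟩
    sum (λ r → w r C suc k) ∎
    where
    open ≤-Reasoning
    occupied⇒∈U : ∀ {u} → Fin (w u) → u ∈ U
    occupied⇒∈U {u} i with u ∈? U
    ... | yes u∈U = u∈U
    ... | no u∉U  = contradiction (subst Fin (U-support u u∉U) i) λ ()
    adjacent⇒sameVertex : ∀ x y → T (adjacent x y) → proj₁ x ≡ proj₁ y
    adjacent⇒sameVertex (u , i) (v , j) x~y with adjacent⁻ {i = i} {j = j} x~y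
    ... | inj₁ u≡v = u≡v
    ... | inj₂ u~v = contradiction (trans (sym u~v) (U-independent u v (occupied⇒∈U i) (occupied⇒∈U j))) λ ()

  module _ (cover : CliqueCover G) where
    open CliqueCover cover

    centreClassSize : Fin n → ℕ
    centreClassSize r = length (colourClass (centre ∘ proj₁) r vertices)

    centreClassSize-supported : SupportedOn centres centreClassSize
    centreClassSize-supported r r∉centres =
      cong length (filter-none (λ y → centre (proj₁ y) ≟ r) {vertices}
        (All.tabulate λ {y} _ centre≡r → r∉centres (subst (_∈ centres) centre≡r (centre∈ (proj₁ y)))))

    ∑-centreClassSize : sum centreClassSize ≡ sum w
    ∑-centreClassSize = trans (∑-length-colourClass (centre ∘ proj₁) vertices) length-vertices

    ∑C-centreClassSize≤π : ∀ k → sum (λ r → centreClassSize r C suc k) ≤ π (suc k) (blowUp G w)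
    ∑C-centreClassSize≤π k =
      ∑C-colourClass≤cliqueCount (centre ∘ proj₁) adjacent k
        (AllPairs.map sameCentre⇒adjacent vertices-unique)
      where
      sameCentre⇒adjacent : ∀ {x y} → x ≢ y → centre (proj₁ x) ≡ centre (proj₁ y) → T (adjacent x y)
      sameCentre⇒adjacent {u , _} {v , _} x≢y same = adjacent⁺ x≢y (sameCentre⇒≡⊎adjacent cover u v same)

theorem7 : (m k n : ℕ) → 1 ≤ m → 2 ≤ k →
    (G : Graph n) → Chordal G →
    (w w′ : Fin n → ℕ) → IsWeighting m w → IsWeighting m w′ →
    UniformAlpha G m w′ →
    π k (blowUp G w′) ≤ π k (blowUp G w)
theorem7 _ zero    _ _ () _ _ _ _ _ _ _
theorem7 m (suc k) n _ _  G chordal w w′ w-weighting w′-weighting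
         (U , (U-independent , U-maximum) , U-support , U-values) = begin
  π (suc k) (blowUp G w′)
    ≤⟨ π-blowUp≤∑C G w′ U-independent U-support k ⟩
  sum (λ r → w′ r C suc k)
    ≤⟨ ∑C-minimisedByUniform centres U X w′ (floorDiv m ∣ U ∣) k
      (U-maximum centres independent) (centreClassSize-supported G w cover) U-support
      (uniformOn-values m U-values) ∑X≡∑w′ ⟩
  sum (λ r → X r C suc k)
    ≤⟨ ∑C-centreClassSize≤π G w cover k ⟩
  π (suc k) (blowUp G w) ∎
  where
  open ≤-Reasoning
  cover : CliqueCover G
  cover = chordal⇒cliqueCover G chordal
  open CliqueCover cover using (centres; independent)
  X : Fin n → ℕ
  X = centreClassSize G w cover
  ∑X≡∑w′ : sum X ≡ sum w′
  ∑X≡∑w′ = trans (∑-centreClassSize G w cover)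
                 (trans (weighting-sum w w-weighting) (sym (weighting-sum w′ w′-weighting)))
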